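{- Let $G$ be a rotor graph, $(\rho,\sigma)$ a rotor-particle configuration, and $(\rho_1,\sigma_1)\in\mathrm{routing}^\infty(\rho,\sigma)$. Then a rotor-particle configuration $(\rho_2,\sigma_2)$ belongs to $\mathrm{routing}^\infty(\rho,\sigma)$ if and only if $\rho_1\sim\rho_2$ and $\sigma_1=\sigma_2$.
   Context: A rotor graph is a stopping directed multigraph $G=(V,A,\mathrm{head},\mathrm{tail})$ (every vertex has a directed path to a sink, i.e. a vertex of outdegree $0$) with a rotor order: a bijection $\theta:A\to A$ which, for each vertex $u$ in the set $V_0$ of non-sink vertices, permutes the set $A^+(u)$ of arcs out of $u$ as a single cycle. A rotor configuration is a map $\rho:V_0\to A$ with $\rho(u)\in A^+(u)$ ($\mathcal{R}$ is their set); a particle configuration is a map $\sigma:V\to\mathbb{Z}$ ($\Sigma$ their group; a vertex $u$ is identified with the configuration with one particle on $u$). For $u\in V_0$, $\mathrm{routing}^+_u(\rho,\sigma)=(\rho',\sigma+\mathrm{head}(\rho(u))-u)$ where $\rho'$ equals $\rho$ except $\rho'(u)=\theta(\rho(u))$; these are commuting bijections; for $r:V_0\to\mathbb{Z}$, $\mathrm{routing}^r$ composes the $(\mathrm{routing}^+_u)^{r(u)}$ (negative powers = inverses). $(\rho,\sigma)\sim(\rho',\sigma')$ iff $\mathrm{routing}^r(\rho,\sigma)=(\rho',\sigma')$ for some $r$; $\rho\sim\rho'$ iff $(\rho,\sigma)\sim(\rho',\sigma)$ for some $\sigma$. $\mathrm{routing}^\infty(\rho,\sigma)$ is the set of $(\rho',\sigma')\sim(\rho,\sigma)$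 with $\sigma'(u)=0$ for all $u\in V_0$. -}

module Defs where

open import Data.Nat using (ℕ; zero; suc)
open import Data.Integer using (ℤ; +_; -[1+_]; _+_; _-_; 0ℤ; 1ℤ)
open import Data.Fin using (Fin; _≟_)
open import Data.Fin.Permutation using (Permutation′; _⟨$⟩ʳ_; _⟨$⟩ˡ_)
open import Data.Bool using (Bool; true; false; T; if_then_else_)
open import Data.List using (List; []; _∷_; allFin; foldr)
open import Data.Bool.ListAction using (any)
open import Data.Product using (Σ; ∃; _×_; _,_; proj₁; proj₂)
open import Relation.Nullary using (¬_; Dec; yes; no)
open import Relation.Nullary.Decidable using (⌊_⌋; T?)
open import Relation.Binary.PropositionalEquality using (_≡_)

iter : ∀ {A : Set} → (A → A) → ℕ → A → A
iter f zero    x = x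
iter f (suc k) x = f (iter f k x)

record Multigraph : Set where
  field
    n m  : ℕ
    head : Fin m → Fin n
    tail : Fin m → Fin n

module _ (G : Multigraph) where
  open Multigraph G

  nonSink : Fin n → Bool
  nonSink u = any (λ a → ⌊ tail a ≟ u ⌋) (allFin m)

  IsSink : Fin n → Set
  IsSink u = ∀ (a : Fin m) → ¬ (tail a ≡ u)

  data Path : Fin n → Fin n → Set where
    here : ∀ {u} → Path u u
    step : ∀ {u v} (a : Fin m) → tail a ≡ u → Path (head a) v → Path u v

  Stopping : Set
  Stopping = ∀ (u : Fin n) → ∃ λ v → Path u v × IsSink v

  IsRotorOrder : Permutation′ m → Set
  IsRotorOrder θ =
    (∀ (a : Fin m) → tail (θ ⟨$⟩ʳ a) ≡ tail a)
    × (∀ (a b : Fin m) → tail a ≡ tail b → ∃ λ k → iter (θ ⟨$⟩ʳ_) k a ≡ b)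

record RotorGraph : Set where
  field
    graph    : Multigraph
    stopping : Stopping graph
    θ        : Permutation′ (Multigraph.m graph)
    rotorOrd : IsRotorOrder graph θ
  open Multigraph graph public

module RG (G : RotorGraph) where
  open RotorGraph G

  V₀ : Set
  V₀ = Σ (Fin n) (λ u → T (nonSink graph u))

  RawRotor : Set
  RawRotor = V₀ → Fin m

  IsRotorConfig : RawRotor → Set
  IsRotorConfig ρ = ∀ (u : V₀) → tail (ρ u) ≡ proj₁ u

  PConf : Set
  PConf = Fin n → ℤ

  δ : Fin n → PConf
  δ v w = if ⌊ w ≟ v ⌋ then 1ℤ else 0ℤ

  Conf : Set
  Conf = RawRotor × PConf

  _≈C_ : Conf → Conf → Set
  (ρ , σ) ≈C (ρ' , σ') = (∀ u → ρ u ≡ ρ' u) × (∀ v → σ v ≡ σ' v)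

  setRotor : RawRotor → V₀ → Fin m → RawRotor
  setRotor ρ u a w = if ⌊ proj₁ w ≟ proj₁ u ⌋ then a else ρ w

  routing⁺ : V₀ → Conf → Conf
  routing⁺ u (ρ , σ) =
    setRotor ρ u (θ ⟨$⟩ʳ ρ u) , (λ w → σ w + δ (head (ρ u)) w - δ (proj₁ u) w)

  routing⁻ : V₀ → Conf → Conf
  routing⁻ u (ρ , σ) =
    let a = θ ⟨$⟩ˡ ρ u in
    setRotor ρ u a , (λ w → σ w - δ (head a) w + δ (proj₁ u) w)

  routingPow : V₀ → ℤ → Conf → Conf
  routingPow u (+ k)     = iter (routing⁺ u) k
  routingPow u -[1+ k ]  = iter (routing⁻ u) (suc k)

  routing : (V₀ → ℤ) → Conf → Conf
  routing r c = foldr stepᵣ c (allFin n)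
    where
    stepᵣ : Fin n → Conf → Conf
    stepᵣ u c' with T? (nonSink graph u)
    ... | yes p = routingPow (u , p) (r (u , p)) c'
    ... | no  _ = c'

  _∼_ : Conf → Conf → Set
  c ∼ c' = ∃ λ (r : V₀ → ℤ) → routing r c ≈C c'

  _∼ρ_ : RawRotor → RawRotor → Set
  ρ ∼ρ ρ' = ∃ λ (σ : PConf) → (ρ , σ) ∼ (ρ' , σ)

  InRoutingInf : Conf → Conf → Set
  InRoutingInf c (ρ' , σ') = IsRotorConfig ρ' × (c ∼ (ρ' , σ')) × (∀ (u : V₀) → σ' (proj₁ u) ≡ 0ℤ)

module Submission where

-- Routing r times at each non-sink turns each rotor ρ(v) by r(v) and changes the particles by
-- Δ r ρ = (particles sent along the arcs) − (particles fired), and Δ is additive under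
-- composition of routings. If (ρ,σ) is routed to (ρ₁,σ₁) by r₁ and to (ρ₂,σ₂) by r₂, both
-- empty on V₀, then r′ = r₂ − r₁ routes (ρ₁,σ₁) to (ρ₂,σ₂) and Δ r′ ρ₁ vanishes on V₀.
-- It vanishes at the sinks as well. Let P be the set of vertices fired a positive number of
-- times. Balance on V₀ makes the count sent out of P (nonnegative) equal to the count sent into
-- P from outside (nonpositive), so nothing crosses the boundary of P and every vertex outside P,
-- in particular every sink, receives a nonpositive count; symmetrically it receives a
-- nonnegative one. Hence σ₁ = σ₂ and ρ₁ ∼ ρ₂; the converse is composition of routings.

open import Defs
open import Data.Bool using (T)
open import Data.Bool.Properties using (T-irrelevant)
open import Data.Empty using (⊥-elim)
open import Data.Fin using (Fin; _≟_)
open import Data.Fin.Permutation using (_⟨$⟩ʳ_; _⟨$⟩ˡ_; inverseˡ; inverseʳ)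
open import Data.Integer as ℤ
  using (ℤ; +_; -[1+_]; _+_; _-_; -_; _*_; 0ℤ; 1ℤ; _≤_; _<_; +≤+; nonNegative)
open import Data.Integer.Properties
  using ( ≤-refl; ≤-reflexive; ≤-antisym; <⇒≤; ≮⇒≥; <-irrefl; <-≤-trans; _<?_
        ; +-mono-≤; neg-mono-≤; neg-cancel-≤; i≤i+j; i≤j+i
        ; +-identityˡ; +-identityʳ; +-comm; +-assoc; +-inverseʳ
        ; *-zeroʳ; *-identityˡ; *-identityʳ; *-distribˡ-+; neg-distrib-+; i-j≡0⇒i≡j; -1*i≡-i )
open import Data.Integer.Tactic.RingSolver using (solve-∀)
open import Data.List using (List; []; _∷_; allFin; foldr)
open import Data.List.Membership.Propositional using (_∈_; _∉_)
open import Data.List.Membership.Propositional.Properties using (∈-allFin)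
open import Data.List.Relation.Unary.All.Properties using (All¬⇒¬Any)
open import Data.List.Relation.Unary.AllPairs using ([]; _∷_)
open import Data.List.Relation.Unary.Any using (here; there)
open import Data.List.Relation.Unary.Unique.Propositional using (Unique)
open import Data.List.Relation.Unary.Unique.Propositional.Properties using (allFin⁺)
open import Data.Nat using (ℕ; zero; suc; z≤n)
open import Data.Product using (_×_; _,_; proj₁; proj₂; uncurry)
open import Function.Bundles using (_⇔_; mk⇔)
open import Relation.Binary.PropositionalEquality
  using (_≡_; _≢_; refl; sym; trans; cong; cong₂; subst; module ≡-Reasoning)
open import Relation.Nullary using (¬_; yes; no)
open import Relation.Nullary.Decidable using (T?; decidable-stable)

module _ {X : Set} where

  ∑ : List X → (X → ℤ) → ℤ
  ∑ []       f = 0ℤ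
  ∑ (x ∷ xs) f = f x + ∑ xs f

  infix 5 ∑
  syntax ∑ xs (λ x → e) = ∑[ x ← xs ] e

  ∑-cong : ∀ xs {f g : X → ℤ} → (∀ x → f x ≡ g x) → ∑ xs f ≡ ∑ xs g
  ∑-cong []       f≗g = refl
  ∑-cong (x ∷ xs) f≗g = cong₂ _+_ (f≗g x) (∑-cong xs f≗g)

  ∑-zero : ∀ xs → ∑[ x ← xs ] 0ℤ ≡ 0ℤ
  ∑-zero []       = refl
  ∑-zero (x ∷ xs) = trans (+-identityˡ _) (∑-zero xs)

  ∑-distrib-+ : ∀ xs (f g : X → ℤ) → ∑[ x ← xs ] (f x + g x) ≡ ∑ xs f + ∑ xs g
  ∑-distrib-+ []       f g = refl
  ∑-distrib-+ (x ∷ xs) f g =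
    trans (cong (_+_ (f x + g x)) (∑-distrib-+ xs f g)) (interchange (f x) (g x) (∑ xs f) (∑ xs g))
    where
    interchange : ∀ a b c d → (a + b) + (c + d) ≡ (a + c) + (b + d)
    interchange = solve-∀

  ∑-distrib-neg : ∀ xs (f : X → ℤ) → ∑[ x ← xs ] - f x ≡ - ∑ xs f
  ∑-distrib-neg []       f = refl
  ∑-distrib-neg (x ∷ xs) f =
    trans (cong (_+_ (- f x)) (∑-distrib-neg xs f)) (sym (neg-distrib-+ (f x) (∑ xs f)))

  ∑-distrib-minus : ∀ xs (f g : X → ℤ) → ∑[ x ← xs ] (f x - g x) ≡ ∑ xs f - ∑ xs g
  ∑-distrib-minus xs f g =
    trans (∑-distrib-+ xs f (λ x → - g x)) (cong (_+_ (∑ xs f)) (∑-distrib-neg xs g))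

  ∑-distribˡ-* : ∀ xs c (f : X → ℤ) → ∑[ x ← xs ] c * f x ≡ c * ∑ xs f
  ∑-distribˡ-* []       c f = sym (*-zeroʳ c)
  ∑-distribˡ-* (x ∷ xs) c f =
    trans (cong (_+_ (c * f x)) (∑-distribˡ-* xs c f)) (sym (*-distribˡ-+ c (f x) (∑ xs f)))

  ∑-comm : ∀ xs ys (F : X → X → ℤ) →
           ∑[ x ← xs ] ∑[ y ← ys ] F x y ≡ ∑[ y ← ys ] ∑[ x ← xs ] F x y
  ∑-comm []       ys F = sym (∑-zero ys)
  ∑-comm (x ∷ xs) ys F = trans (cong (_+_ (∑ ys (F x))) (∑-comm xs ys F))
                               (sym (∑-distrib-+ ys (F x) (λ y → ∑[ x′ ← xs ] F x′ y)))

  ∑-nonneg : ∀ xs {f : X → ℤ} → (∀ x → 0ℤ ≤ f x) → 0ℤ ≤ ∑ xs f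
  ∑-nonneg []       f≥0 = ≤-refl
  ∑-nonneg (x ∷ xs) f≥0 = +-mono-≤ (f≥0 x) (∑-nonneg xs f≥0)

  ∑-nonpos : ∀ xs {f : X → ℤ} → (∀ x → f x ≤ 0ℤ) → ∑ xs f ≤ 0ℤ
  ∑-nonpos []       f≤0 = ≤-refl
  ∑-nonpos (x ∷ xs) f≤0 = +-mono-≤ (f≤0 x) (∑-nonpos xs f≤0)

  ∑-nonneg-≡0 : ∀ xs {f : X → ℤ} → (∀ x → 0ℤ ≤ f x) → ∑ xs f ≡ 0ℤ →
                ∀ {x} → x ∈ xs → f x ≡ 0ℤ
  ∑-nonneg-≡0 (y ∷ xs) {f} f≥0 sum≡0 (here refl) = ≤-antisym fy≤0 (f≥0 y)
    where
    fy≤0 : f y ≤ 0ℤ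
    fy≤0 = subst (f y ≤_) sum≡0 (i≤i+j (f y) (∑ xs f) {{nonNegative (∑-nonneg xs f≥0)}})
  ∑-nonneg-≡0 (y ∷ xs) {f} f≥0 sum≡0 (there x∈xs) = ∑-nonneg-≡0 xs f≥0 rest≡0 x∈xs
    where
    rest≤0 : ∑ xs f ≤ 0ℤ
    rest≤0 = subst (∑ xs f ≤_) sum≡0 (i≤j+i (∑ xs f) (f y) {{nonNegative (f≥0 y)}})
    rest≡0 : ∑ xs f ≡ 0ℤ
    rest≡0 = ≤-antisym rest≤0 (∑-nonneg xs f≥0)

  ∑-supported : ∀ xs (f : X → ℤ) x → x ∉ xs → (∀ y → y ≢ x → f y ≡ 0ℤ) → ∑ xs f ≡ 0ℤ
  ∑-supported []       f x x∉xs f≡0 = refl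
  ∑-supported (y ∷ xs) f x x∉xs f≡0 =
    cong₂ _+_ (f≡0 y (λ y≡x → x∉xs (here (sym y≡x))))
              (∑-supported xs f x (λ x∈xs → x∉xs (there x∈xs)) f≡0)

  ∑-select : ∀ {xs} (f : X → ℤ) {x} → Unique xs → x ∈ xs →
             (∀ y → y ≢ x → f y ≡ 0ℤ) → ∑ xs f ≡ f x
  ∑-select {y ∷ xs} f (y∉xs ∷ _) (here refl) f≡0 =
    trans (cong (_+_ (f y)) (∑-supported xs f y (All¬⇒¬Any y∉xs) f≡0)) (+-identityʳ (f y))
  ∑-select {y ∷ xs} f {x} (y∉xs ∷ uniq) (there x∈xs) f≡0 =
    trans (cong₂ _+_ (f≡0 y y≢x) (∑-select f uniq x∈xs f≡0)) (+-identityˡ (f x))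
    where
    y≢x : y ≢ x
    y≢x refl = All¬⇒¬Any y∉xs x∈xs

module Flow {X : Set} (xs : List X) (xs-complete : ∀ x → x ∈ xs) where

  inflow : (X → X → ℤ) → X → ℤ
  inflow A v = ∑[ w ← xs ] A w v

  record IsOutflow (A : X → X → ℤ) (R : X → ℤ) : Set where
    field
      outflow : ∀ w → ∑ xs (A w) ≡ R w
      nonneg  : ∀ w v → 0ℤ ≤ R w → 0ℤ ≤ A w v
      nonpos  : ∀ w v → R w ≤ 0ℤ → A w v ≤ 0ℤ

  neg-isOutflow : ∀ {A R} → IsOutflow A R → IsOutflow (λ w v → - A w v) (λ w → - R w)
  neg-isOutflow {A} {R} isA = record
    { outflow = λ w → trans (∑-distrib-neg xs (A w)) (cong -_ (outflow w))
    ; nonneg  = λ w v 0≤-R → neg-mono-≤ (nonpos w v (neg-cancel-≤ {0ℤ} {R w} 0≤-R))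
    ; nonpos  = λ w v -R≤0 → neg-mono-≤ (nonneg w v (neg-cancel-≤ {R w} {0ℤ} -R≤0))
    }
    where open IsOutflow isA

  -- χ is the indicator of P = {R > 0}. What leaves P (counted ≥ 0) and what enters P (sent by
  -- vertices with R ≤ 0, so counted ≤ 0) balance, hence nothing crosses the boundary of P.
  module _ {A R} (isA : IsOutflow A R) (balanced : ∀ v → 0ℤ < R v → inflow A v ≡ R v) where
    open IsOutflow isA

    private
      χ : X → ℤ
      χ w with 0ℤ <? R w
      ... | yes _ = 1ℤ
      ... | no  _ = 0ℤ

      crossing : X → X → ℤ
      crossing w v = (χ w - χ v) * A w v

      crossing-nonneg : ∀ w v → 0ℤ ≤ crossing w v
      crossing-nonneg w v with 0ℤ <? R w | 0ℤ <? R v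
      ... | yes _    | yes _ = ≤-refl
      ... | yes 0<Rw | no  _ = subst (0ℤ ≤_) (sym (*-identityˡ (A w v))) (nonneg w v (<⇒≤ 0<Rw))
      ... | no  Rw≯0 | yes _ =
        subst (0ℤ ≤_) (sym (-1*i≡-i (A w v))) (neg-mono-≤ (nonpos w v (≮⇒≥ Rw≯0)))
      ... | no  _    | no  _ = ≤-refl

      χ-balanced : ∀ v → χ v * inflow A v ≡ χ v * R v
      χ-balanced v with 0ℤ <? R v
      ... | yes 0<Rv = cong (1ℤ *_) (balanced v 0<Rv)
      ... | no  _    = refl

      total-crossing : ∑[ w ← xs ] ∑[ v ← xs ] crossing w v ≡ 0ℤ
      total-crossing = begin
        ∑[ w ← xs ] ∑[ v ← xs ] crossing w v
          ≡⟨ ∑-cong xs (λ w → trans (∑-cong xs (λ v → distrib (χ w) (χ v) (A w v)))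
                                    (∑-distrib-minus xs (λ v → χ w * A w v) (λ v → χ v * A w v))) ⟩
        ∑[ w ← xs ] ((∑[ v ← xs ] χ w * A w v) - (∑[ v ← xs ] χ v * A w v))
          ≡⟨ ∑-distrib-minus xs _ _ ⟩
        (∑[ w ← xs ] ∑[ v ← xs ] χ w * A w v) - (∑[ w ← xs ] ∑[ v ← xs ] χ v * A w v)
          ≡⟨ cong₂ _-_ (∑-cong xs λ w → trans (∑-distribˡ-* xs (χ w) (A w))
                                             (cong (χ w *_) (outflow w)))
                       (trans (∑-comm xs xs (λ w v → χ v * A w v))
                              (∑-cong xs λ v → trans (∑-distribˡ-* xs (χ v) (λ w → A w v))
                                                     (χ-balanced v))) ⟩
        (∑[ w ← xs ] χ w * R w) - (∑[ v ← xs ] χ v * R v)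
          ≡⟨ +-inverseʳ (∑[ w ← xs ] χ w * R w) ⟩
        0ℤ ∎
        where
        open ≡-Reasoning
        distrib : ∀ a b c → (a - b) * c ≡ a * c - b * c
        distrib = solve-∀

      crossing-zero : ∀ w v → crossing w v ≡ 0ℤ
      crossing-zero w v =
        ∑-nonneg-≡0 xs (crossing-nonneg w) row-w≡0 (xs-complete v)
        where
        row-w≡0 : ∑[ v ← xs ] crossing w v ≡ 0ℤ
        row-w≡0 = ∑-nonneg-≡0 xs (λ w′ → ∑-nonneg xs (crossing-nonneg w′)) total-crossing (xs-complete w)

    inflow-nonpos : ∀ v → R v ≤ 0ℤ → inflow A v ≤ 0ℤ
    inflow-nonpos v Rv≤0 = ∑-nonpos xs A·v≤0
      where
      A·v≤0 : ∀ w → A w v ≤ 0ℤ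
      A·v≤0 w with 0ℤ <? R w | 0ℤ <? R v | crossing-zero w v
      ... | yes _    | yes 0<Rv | _ = ⊥-elim (<-irrefl refl (<-≤-trans 0<Rv Rv≤0))
      ... | yes _    | no  _    | A≡0 = ≤-reflexive (trans (sym (*-identityˡ (A w v))) A≡0)
      ... | no  Rw≯0 | _        | _ = nonpos w v (≮⇒≥ Rw≯0)

  inflow≡outflow : ∀ {A R} → IsOutflow A R → (∀ v → R v ≢ 0ℤ → inflow A v ≡ R v) →
                   ∀ v → inflow A v ≡ R v
  inflow≡outflow {A} {R} isA balanced v with R v ℤ.≟ 0ℤ
  ... | no  Rv≢0 = balanced v Rv≢0
  ... | yes Rv≡0 = trans (≤-antisym upper lower) (sym Rv≡0)
    where
    upper : inflow A v ≤ 0ℤ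
    upper = inflow-nonpos isA (λ u 0<Ru → balanced u (λ Ru≡0 → <-irrefl (sym Ru≡0) 0<Ru))
                          v (≤-reflexive Rv≡0)
    lower : 0ℤ ≤ inflow A v
    lower = neg-cancel-≤ {inflow A v} {0ℤ}
      (subst (_≤ 0ℤ) (∑-distrib-neg xs (λ w → A w v))
        (inflow-nonpos (neg-isOutflow isA)
          (λ u 0<-Ru → trans (∑-distrib-neg xs (λ w → A w u))
                             (cong -_ (balanced u (λ Ru≡0 → <-irrefl (sym (cong -_ Ru≡0)) 0<-Ru))))
          v (≤-reflexive (cong -_ Rv≡0))))

ℤ-ind : (P : ℤ → Set) → P 0ℤ → (∀ k → P k → P (ℤ.suc k)) → (∀ k → P (ℤ.suc k) → P k) →
        ∀ k → P k
ℤ-ind P P0 up down (+ zero)     = P0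
ℤ-ind P P0 up down (+ suc k)    = up (+ k) (ℤ-ind P P0 up down (+ k))
ℤ-ind P P0 up down -[1+ zero ]  = down -[1+ 0 ] P0
ℤ-ind P P0 up down -[1+ suc k ] = down -[1+ suc k ] (ℤ-ind P P0 up down -[1+ k ])

ℤ-recursion-unique : {Y : Set} (F G : ℤ → Y) (s : ℤ → Y → Y) →
  (∀ k {x y} → s k x ≡ s k y → x ≡ y) → F 0ℤ ≡ G 0ℤ →
  (∀ k → F (ℤ.suc k) ≡ s k (F k)) → (∀ k → G (ℤ.suc k) ≡ s k (G k)) → ∀ k → F k ≡ G k
ℤ-recursion-unique F G s s-injective F0≡G0 F-suc G-suc = ℤ-ind (λ k → F k ≡ G k) F0≡G0
  (λ k Fk≡Gk → trans (F-suc k) (trans (cong (s k) Fk≡Gk) (sym (G-suc k))))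
  (λ k Fk+1≡Gk+1 → s-injective k (trans (sym (F-suc k)) (trans Fk+1≡Gk+1 (G-suc k))))

+-suc : ∀ j k → j + (1ℤ + k) ≡ 1ℤ + (j + k)
+-suc = solve-∀

i-j+j≡i : ∀ i j → i - j + j ≡ i
i-j+j≡i = solve-∀

i+j-j≡i : ∀ i j → i + j - j ≡ i
i+j-j≡i = solve-∀

i+j-i≡j : ∀ i j → i + j - i ≡ j
i+j-i≡j = solve-∀

i+[j-i]≡j : ∀ i j → i + (j - i) ≡ j
i+[j-i]≡j = solve-∀

+-cancelʳ : ∀ {i j} k → i + k ≡ j + k → i ≡ j
+-cancelʳ {i} {j} k i+k≡j+k =
  trans (sym (i+j-j≡i i k)) (trans (cong (_- k) i+k≡j+k) (i+j-j≡i j k))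

module _ (G : RotorGraph) where
  open RotorGraph G
  open RG G

  θʳ θˡ : Fin m → Fin m
  θʳ a = θ ⟨$⟩ʳ a
  θˡ a = θ ⟨$⟩ˡ a

  turn : ℤ → Fin m → Fin m
  turn (+ k)    a = iter θʳ k a
  turn -[1+ k ] a = iter θˡ (suc k) a

  turn-suc : ∀ k a → turn (ℤ.suc k) a ≡ θʳ (turn k a)
  turn-suc (+ k)        a = refl
  turn-suc -[1+ zero ]  a = sym (inverseʳ θ)
  turn-suc -[1+ suc k ] a = sym (inverseʳ θ)

  θʳ-injective : ∀ {a b} → θʳ a ≡ θʳ b → a ≡ b
  θʳ-injective θa≡θb = trans (sym (inverseˡ θ)) (trans (cong θˡ θa≡θb) (inverseˡ θ))

  turn-+ : ∀ j k a → turn (j + k) a ≡ turn k (turn j a)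
  turn-+ j k a = ℤ-recursion-unique (λ k → turn (j + k) a) (λ k → turn k (turn j a))
    (λ _ → θʳ) (λ _ → θʳ-injective)
    (cong (λ i → turn i a) (+-identityʳ j))
    (λ k → trans (cong (λ i → turn i a) (+-suc j k)) (turn-suc (j + k) a))
    (λ k → turn-suc k (turn j a))
    k

  -- Particles delivered to each vertex by k forward (resp. backward) routings from rotor a;
  -- backward routing takes particles back, hence the minus sign.
  sent⁺ sent⁻ : Fin m → ℕ → PConf
  sent⁺ a zero    w = 0ℤ
  sent⁺ a (suc k) w = sent⁺ a k w + δ (head (iter θʳ k a)) w
  sent⁻ a zero    w = 0ℤ
  sent⁻ a (suc k) w = sent⁻ a k w - δ (head (iter θˡ (suc k) a)) w

  sent : Fin m → ℤ → PConf
  sent a (+ k)    = sent⁺ a k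
  sent a -[1+ k ] = sent⁻ a (suc k)

  sent-suc : ∀ a k w → sent a (ℤ.suc k) w ≡ sent a k w + δ (head (turn k a)) w
  sent-suc a (+ k)        w = refl
  sent-suc a -[1+ zero ]  w = sym (i-j+j≡i 0ℤ (δ (head (θˡ a)) w))
  sent-suc a -[1+ suc k ] w =
    sym (i-j+j≡i (sent⁻ a (suc k) w) (δ (head (iter θˡ (suc (suc k)) a)) w))

  sent-+ : ∀ a j k w → sent a (j + k) w ≡ sent a j w + sent (turn j a) k w
  sent-+ a j k w = ℤ-recursion-unique (λ k → sent a (j + k) w) (λ k → sent a j w + sent (turn j a) k w)
    (λ k x → x + δ (head (turn k (turn j a))) w) (λ k → +-cancelʳ _)
    (trans (cong (λ i → sent a i w) (+-identityʳ j)) (sym (+-identityʳ (sent a j w))))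
    (λ k → begin
      sent a (j + ℤ.suc k) w                             ≡⟨ cong (λ i → sent a i w) (+-suc j k) ⟩
      sent a (ℤ.suc (j + k)) w                           ≡⟨ sent-suc a (j + k) w ⟩
      sent a (j + k) w + δ (head (turn (j + k) a)) w     ≡⟨ cong (λ b → sent a (j + k) w + δ (head b) w)
                                                                  (turn-+ j k a) ⟩
      sent a (j + k) w + δ (head (turn k (turn j a))) w  ∎)
    (λ k → trans (cong (_+_ (sent a j w)) (sent-suc (turn j a) k w))
                 (sym (+-assoc (sent a j w) (sent (turn j a) k w) _)))
    k
    where open ≡-Reasoning

  δ-≡ : ∀ x → δ x x ≡ 1ℤ
  δ-≡ x with x ≟ x
  ... | yes _   = refl
  ... | no  x≢x = ⊥-elim (x≢x refl)

  δ-≢ : ∀ {x y} → y ≢ x → δ x y ≡ 0ℤ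
  δ-≢ {x} {y} y≢x with y ≟ x
  ... | yes y≡x = ⊥-elim (y≢x y≡x)
  ... | no  _   = refl

  δ-nonneg : ∀ x y → 0ℤ ≤ δ x y
  δ-nonneg x y with y ≟ x
  ... | yes _ = +≤+ z≤n
  ... | no  _ = +≤+ z≤n

  ∑-δ : ∀ x → ∑ (allFin n) (δ x) ≡ 1ℤ
  ∑-δ x = trans (∑-select (δ x) (allFin⁺ n) (∈-allFin x) (λ y → δ-≢)) (δ-≡ x)

  ∑-*δ : ∀ (f : Fin n → ℤ) w → ∑[ u ← allFin n ] f u * δ u w ≡ f w
  ∑-*δ f w = trans (∑-select (λ u → f u * δ u w) (allFin⁺ n) (∈-allFin w) off-w)
                   (trans (cong (f w *_) (δ-≡ w)) (*-identityʳ (f w)))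
    where
    off-w : ∀ u → u ≢ w → f u * δ u w ≡ 0ℤ
    off-w u u≢w = trans (cong (f u *_) (δ-≢ (λ w≡u → u≢w (sym w≡u)))) (*-zeroʳ (f u))

  ∑-sent : ∀ a k → ∑ (allFin n) (sent a k) ≡ k
  ∑-sent a = ℤ-recursion-unique (λ k → ∑ (allFin n) (sent a k)) (λ k → k)
    (λ _ x → x + 1ℤ) (λ _ → +-cancelʳ 1ℤ)
    (∑-zero (allFin n))
    (λ k → trans (∑-cong (allFin n) (sent-suc a k))
                 (trans (∑-distrib-+ (allFin n) (sent a k) _)
                        (cong (_+_ (∑ (allFin n) (sent a k))) (∑-δ (head (turn k a))))))
    (λ k → +-comm 1ℤ k)

  sent-nonneg : ∀ a k w → 0ℤ ≤ k → 0ℤ ≤ sent a k w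
  sent-nonneg a (+ k) w _ = go k
    where
    go : ∀ k → 0ℤ ≤ sent⁺ a k w
    go zero    = ≤-refl
    go (suc k) = +-mono-≤ (go k) (δ-nonneg _ w)

  sent-nonpos : ∀ a k w → k ≤ 0ℤ → sent a k w ≤ 0ℤ
  sent-nonpos a (+ zero)    w _         = ≤-refl
  sent-nonpos a (+ suc k)   w (+≤+ ())
  sent-nonpos a -[1+ k ]    w _         = go (suc k)
    where
    go : ∀ k → sent⁻ a k w ≤ 0ℤ
    go zero    = ≤-refl
    go (suc k) = +-mono-≤ (go k) (neg-mono-≤ (δ-nonneg _ w))

  ≈C-particles : ∀ {c ρ σ τ} → c ≈C (ρ , σ) → (∀ w → σ w ≡ τ w) → c ≈C (ρ , τ)
  ≈C-particles (ρ≗ , σ≗) σ≗τ = ρ≗ , λ w → trans (σ≗ w) (σ≗τ w)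

  V₀-≡ : ∀ {v v′ : V₀} → proj₁ v ≡ proj₁ v′ → v ≡ v′
  V₀-≡ {u , p} {.u , p′} refl = cong (u ,_) (T-irrelevant p p′)

  setRotor-≡ : ∀ ρ u a {v} → proj₁ v ≡ proj₁ u → setRotor ρ u a v ≡ a
  setRotor-≡ ρ u a {v} v≡u with proj₁ v ≟ proj₁ u
  ... | yes _   = refl
  ... | no  v≢u = ⊥-elim (v≢u v≡u)

  setRotor-≢ : ∀ ρ u a {v} → proj₁ v ≢ proj₁ u → setRotor ρ u a v ≡ ρ v
  setRotor-≢ ρ u a {v} v≢u with proj₁ v ≟ proj₁ u
  ... | yes v≡u = ⊥-elim (v≢u v≡u)
  ... | no  _   = refl

  setRotor-self : ∀ ρ u v → ρ v ≡ setRotor ρ u (ρ u) v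
  setRotor-self ρ u v with proj₁ v ≟ proj₁ u
  ... | yes v≡u = cong ρ (V₀-≡ v≡u)
  ... | no  _   = refl

  setRotor-overwrite : ∀ ρ ρ′ u a b → (∀ v → ρ′ v ≡ setRotor ρ u a v) →
                       ∀ v → setRotor ρ′ u b v ≡ setRotor ρ u b v
  setRotor-overwrite ρ ρ′ u a b ρ′≗ v with proj₁ v ≟ proj₁ u
  ... | yes _   = refl
  ... | no  v≢u = trans (ρ′≗ v) (setRotor-≢ ρ u a v≢u)

  module _ (u : V₀) {ρ : RawRotor} {σ : PConf} {c : Conf} {a : Fin m}
           (c≈ : c ≈C (setRotor ρ u a , σ)) where

    private
      rotor-at-u : proj₁ c u ≡ a
      rotor-at-u = trans (proj₁ c≈ u) (setRotor-≡ ρ u a refl)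

      rotors-elsewhere : ∀ b v → setRotor (proj₁ c) u b v ≡ setRotor ρ u b v
      rotors-elsewhere b = setRotor-overwrite ρ (proj₁ c) u a b (proj₁ c≈)

    routing⁺-setRotor :
      routing⁺ u c ≈C (setRotor ρ u (θʳ a) , λ w → σ w + δ (head a) w - δ (proj₁ u) w)
    routing⁺-setRotor =
        (λ v → trans (rotors-elsewhere _ v) (cong (λ b → setRotor ρ u (θʳ b) v) rotor-at-u))
      , (λ w → cong₂ (λ s b → s + δ (head b) w - δ (proj₁ u) w) (proj₂ c≈ w) rotor-at-u)

    routing⁻-setRotor :
      routing⁻ u c ≈C (setRotor ρ u (θˡ a) , λ w → σ w - δ (head (θˡ a)) w + δ (proj₁ u) w)
    routing⁻-setRotor =
        (λ v → trans (rotors-elsewhere _ v) (cong (λ b → setRotor ρ u (θˡ b) v) rotor-at-u))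
      , (λ w → cong₂ (λ s b → s - δ (head (θˡ b)) w + δ (proj₁ u) w) (proj₂ c≈ w) rotor-at-u)

  displacement : V₀ → Fin m → ℤ → PConf
  displacement u a k w = sent a k w - k * δ (proj₁ u) w

  routing⁺-iter : ∀ u k ρ σ →
    iter (routing⁺ u) k (ρ , σ)
      ≈C (setRotor ρ u (iter θʳ k (ρ u)) , λ w → σ w + displacement u (ρ u) (+ k) w)
  routing⁺-iter u zero    ρ σ = setRotor-self ρ u , λ w → sym (+-identityʳ (σ w))
  routing⁺-iter u (suc k) ρ σ =
    ≈C-particles (routing⁺-setRotor u (routing⁺-iter u k ρ σ)) λ w →
      fire (σ w) (sent⁺ (ρ u) k w) (+ k) (δ (proj₁ u) w) (δ (head (iter θʳ k (ρ u))) w)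
    where
    fire : ∀ σ s k d e → σ + (s - k * d) + e - d ≡ σ + ((s + e) - (1ℤ + k) * d)
    fire = solve-∀

  routing⁻-iter : ∀ u k ρ σ →
    iter (routing⁻ u) k (ρ , σ)
      ≈C (setRotor ρ u (iter θˡ k (ρ u)) , λ w → σ w + (sent⁻ (ρ u) k w + + k * δ (proj₁ u) w))
  routing⁻-iter u zero    ρ σ = setRotor-self ρ u , λ w → sym (+-identityʳ (σ w))
  routing⁻-iter u (suc k) ρ σ =
    ≈C-particles (routing⁻-setRotor u (routing⁻-iter u k ρ σ)) λ w →
      unfire (σ w) (sent⁻ (ρ u) k w) (+ k) (δ (proj₁ u) w) (δ (head (iter θˡ (suc k) (ρ u))) w)
    where
    unfire : ∀ σ s k d e → σ + (s + k * d) - e + d ≡ σ + ((s - e) + (1ℤ + k) * d)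
    unfire = solve-∀

  routingPow-≈ : ∀ u k ρ σ →
    routingPow u k (ρ , σ) ≈C (setRotor ρ u (turn k (ρ u)) , λ w → σ w + displacement u (ρ u) k w)
  routingPow-≈ u (+ k)    ρ σ = routing⁺-iter u k ρ σ
  routingPow-≈ u -[1+ k ] ρ σ =
    ≈C-particles (routing⁻-iter u (suc k) ρ σ) λ w →
      cong (_+_ (σ w)) (negate (sent⁻ (ρ u) (suc k) w) (+ suc k) (δ (proj₁ u) w))
    where
    negate : ∀ s k d → s + k * d ≡ s - (- k) * d
    negate = solve-∀

  onV₀ : (V₀ → ℤ) → Fin n → ℤ
  onV₀ f u with T? (nonSink graph u)
  ... | yes p = f (u , p)
  ... | no  _ = 0ℤ

  onV₀-nonSink : ∀ f (v : V₀) → onV₀ f (proj₁ v) ≡ f v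
  onV₀-nonSink f (u , p) with T? (nonSink graph u)
  ... | yes q  = cong (λ q → f (u , q)) (T-irrelevant q p)
  ... | no  ¬p = ⊥-elim (¬p p)

  onV₀-sink : ∀ f {u} → ¬ T (nonSink graph u) → onV₀ f u ≡ 0ℤ
  onV₀-sink f {u} ¬p with T? (nonSink graph u)
  ... | yes p = ⊥-elim (¬p p)
  ... | no  _ = refl

  turnBy : (V₀ → ℤ) → RawRotor → RawRotor
  turnBy r ρ v = turn (r v) (ρ v)

  firings : (V₀ → ℤ) → Fin n → ℤ
  firings = onV₀

  outflowFrom : (V₀ → ℤ) → RawRotor → Fin n → PConf
  outflowFrom r ρ u w = onV₀ (λ v → sent (ρ v) (r v) w) u

  Δ : (V₀ → ℤ) → RawRotor → PConf
  Δ r ρ w = (∑[ u ← allFin n ] outflowFrom r ρ u w) - firings r w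

  transfer : (V₀ → ℤ) → RawRotor → Fin n → PConf
  transfer r ρ u w = onV₀ (λ v → displacement v (ρ v) (r v) w) u

  transfer-split : ∀ r ρ u w → transfer r ρ u w ≡ outflowFrom r ρ u w - firings r u * δ u w
  transfer-split r ρ u w with T? (nonSink graph u)
  ... | yes _ = refl
  ... | no  _ = refl

  ∑-transfer : ∀ r ρ w → ∑[ u ← allFin n ] transfer r ρ u w ≡ Δ r ρ w
  ∑-transfer r ρ w = begin
    ∑[ u ← allFin n ] transfer r ρ u w
      ≡⟨ ∑-cong (allFin n) (λ u → transfer-split r ρ u w) ⟩
    ∑[ u ← allFin n ] (outflowFrom r ρ u w - firings r u * δ u w)
      ≡⟨ ∑-distrib-minus (allFin n) _ _ ⟩
    inflow - (∑[ u ← allFin n ] firings r u * δ u w)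
      ≡⟨ cong (_-_ inflow) (∑-*δ (firings r) w) ⟩
    Δ r ρ w ∎
    where
    open ≡-Reasoning
    inflow : ℤ
    inflow = ∑[ u ← allFin n ] outflowFrom r ρ u w

  transfer-cong : ∀ r {ρ ρ′} u → (∀ v → proj₁ v ≡ u → ρ v ≡ ρ′ v) →
                  ∀ w → transfer r ρ u w ≡ transfer r ρ′ u w
  transfer-cong r u ρ≗ρ′ w with T? (nonSink graph u)
  ... | yes p = cong (λ a → displacement (u , p) a (r (u , p)) w) (ρ≗ρ′ (u , p) refl)
  ... | no  _ = refl

  record Routed (r : V₀ → ℤ) (us : List (Fin n)) (c c′ : Conf) : Set where
    field
      turned    : ∀ v → proj₁ v ∈ us → proj₁ c′ v ≡ turn (r v) (proj₁ c v)
      untouched : ∀ v → proj₁ v ∉ us → proj₁ c′ v ≡ proj₁ c v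
      particles : ∀ w → proj₂ c′ w ≡ proj₂ c w + (∑[ u ← us ] transfer r (proj₁ c) u w)

  routed-[] : ∀ r c → Routed r [] c c
  routed-[] r c = record
    { turned    = λ v ()
    ; untouched = λ v _ → refl
    ; particles = λ w → sym (+-identityʳ (proj₂ c w))
    }

  routed-∷ : ∀ {r u us c c′ c″} → u ∉ us →
             Routed r us c c′ → Routed r (u ∷ []) c′ c″ → Routed r (u ∷ us) c c″
  routed-∷ {r} {u} {us} {c} {c′} {c″} u∉us R R′ = record
    { turned    = turned″
    ; untouched = λ v v∉ → trans (R′.untouched v (λ { (here v≡u) → v∉ (here v≡u) }))
                                 (R.untouched v (λ v∈ → v∉ (there v∈)))
    ; particles = particles″
    }
    where
    module R = Routed R
    module R′ = Routed R′
    unmoved : ∀ v → proj₁ v ≡ u → proj₁ c′ v ≡ proj₁ c v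
    unmoved v v≡u = R.untouched v (λ v∈ → u∉us (subst (_∈ us) v≡u v∈))
    turned″ : ∀ v → proj₁ v ∈ u ∷ us → proj₁ c″ v ≡ turn (r v) (proj₁ c v)
    turned″ v (here v≡u) = trans (R′.turned v (here v≡u)) (cong (turn (r v)) (unmoved v v≡u))
    turned″ v (there v∈) =
      trans (R′.untouched v (λ { (here v≡u) → u∉us (subst (_∈ us) v≡u v∈) })) (R.turned v v∈)
    particles″ : ∀ w → proj₂ c″ w ≡ proj₂ c w + (∑[ u′ ← u ∷ us ] transfer r (proj₁ c) u′ w)
    particles″ w = begin
      proj₂ c″ w                         ≡⟨ R′.particles w ⟩
      proj₂ c′ w + (transfer r (proj₁ c′) u w + 0ℤ)
        ≡⟨ cong₂ (λ s t → s + (t + 0ℤ)) (R.particles w) (transfer-cong r u unmoved w) ⟩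
      proj₂ c w + S + (t + 0ℤ)           ≡⟨ reassoc (proj₂ c w) S t ⟩
      proj₂ c w + (t + S)                ∎
      where
      open ≡-Reasoning
      S t : ℤ
      S = ∑[ u′ ← us ] transfer r (proj₁ c) u′ w
      t = transfer r (proj₁ c) u w
      reassoc : ∀ σ s t → σ + s + (t + 0ℤ) ≡ σ + (t + s)
      reassoc = solve-∀

  -- The step function of `routing` is local to its where-block; it is recovered from the
  -- defining equation of `routing` by unification.
  private
    stepOf : ∀ {A B : Set} {f : A → B → B} {c : B} {xs : List A} {y : B} →
             foldr f c xs ≡ y → A → B → B
    stepOf {f = f} _ = f

  routingStep : (V₀ → ℤ) → Conf → Fin n → Conf → Conf
  routingStep r c₀ = stepOf {c = c₀} {xs = allFin n} (refl {x = routing r c₀})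

  routingStep-routed : ∀ r c₀ u c → Routed r (u ∷ []) c (routingStep r c₀ u c)
  routingStep-routed r c₀ u c with T? (nonSink graph u)
  ... | yes p = record
    { turned    = λ { v (here v≡u) → trans (proj₁ pow≈ v)
                                       (trans (setRotor-≡ (proj₁ c) v₀ _ v≡u)
                                              (cong (λ v′ → turn (r v′) (proj₁ c v′)) (V₀-≡ (sym v≡u)))) }
    ; untouched = λ v v∉ → trans (proj₁ pow≈ v) (setRotor-≢ (proj₁ c) v₀ _ (λ v≡u → v∉ (here v≡u)))
    ; particles = λ w → trans (proj₂ pow≈ w) (cong (_+_ (proj₂ c w)) (sym (transfer-at-u w)))
    }
    where
    v₀ : V₀
    v₀ = u , p
    pow≈ : routingPow v₀ (r v₀) c
             ≈C (setRotor (proj₁ c) v₀ (turn (r v₀) (proj₁ c v₀)) ,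
                 λ w → proj₂ c w + displacement v₀ (proj₁ c v₀) (r v₀) w)
    pow≈ = routingPow-≈ v₀ (r v₀) (proj₁ c) (proj₂ c)
    transfer-at-u : ∀ w → transfer r (proj₁ c) u w + 0ℤ ≡ displacement v₀ (proj₁ c v₀) (r v₀) w
    transfer-at-u w = trans (+-identityʳ _) (onV₀-nonSink _ v₀)
  ... | no ¬p = record
    { turned    = λ { v (here refl) → ⊥-elim (¬p (proj₂ v)) }
    ; untouched = λ v _ → refl
    ; particles = λ w → sym (trans (cong (λ t → proj₂ c w + (t + 0ℤ)) (onV₀-sink _ ¬p))
                                   (+-identityʳ (proj₂ c w)))
    }

  foldr-routed : ∀ r c₀ c us → Unique us → Routed r us c (foldr (routingStep r c₀) c us)
  foldr-routed r c₀ c []       _             = routed-[] r c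
  foldr-routed r c₀ c (u ∷ us) (u∉us ∷ uniq) =
    routed-∷ (All¬⇒¬Any u∉us) (foldr-routed r c₀ c us uniq) (routingStep-routed r c₀ u _)

  routing-≈ : ∀ r ρ σ → routing r (ρ , σ) ≈C (turnBy r ρ , λ w → σ w + Δ r ρ w)
  routing-≈ r ρ σ =
      (λ v → turned v (∈-allFin (proj₁ v)))
    , (λ w → trans (particles w) (cong (_+_ (σ w)) (∑-transfer r ρ w)))
    where open Routed (foldr-routed r (ρ , σ) (ρ , σ) (allFin n) (allFin⁺ n))

  onV₀-+ : ∀ {f g h} u → (∀ v → f v ≡ g v + h v) → onV₀ f u ≡ onV₀ g u + onV₀ h u
  onV₀-+ u f≗g+h with T? (nonSink graph u)
  ... | yes p = f≗g+h (u , p)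
  ... | no  _ = refl

  Δ-+ : ∀ {r r₁ r₂ ρ ρ₁} → (∀ v → r v ≡ r₁ v + r₂ v) → (∀ v → ρ₁ v ≡ turn (r₁ v) (ρ v)) →
        ∀ w → Δ r ρ w ≡ Δ r₁ ρ w + Δ r₂ ρ₁ w
  Δ-+ {r} {r₁} {r₂} {ρ} {ρ₁} r≗r₁+r₂ ρ₁≗ w = begin
    (∑[ u ← allFin n ] outflowFrom r ρ u w) - firings r w
      ≡⟨ cong₂ _-_ (trans (∑-cong (allFin n) λ u → onV₀-+ u (sent-split w))
                          (∑-distrib-+ (allFin n) _ _))
                   (onV₀-+ w r≗r₁+r₂) ⟩
    (out₁ + out₂) - (firings r₁ w + firings r₂ w)
      ≡⟨ regroup out₁ out₂ (firings r₁ w) (firings r₂ w) ⟩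
    Δ r₁ ρ w + Δ r₂ ρ₁ w ∎
    where
    open ≡-Reasoning
    out₁ out₂ : ℤ
    out₁ = ∑[ u ← allFin n ] outflowFrom r₁ ρ u w
    out₂ = ∑[ u ← allFin n ] outflowFrom r₂ ρ₁ u w
    sent-split : ∀ w v → sent (ρ v) (r v) w ≡ sent (ρ v) (r₁ v) w + sent (ρ₁ v) (r₂ v) w
    sent-split w v = begin
      sent (ρ v) (r v) w                                        ≡⟨ cong (λ k → sent (ρ v) k w) (r≗r₁+r₂ v) ⟩
      sent (ρ v) (r₁ v + r₂ v) w                                ≡⟨ sent-+ (ρ v) (r₁ v) (r₂ v) w ⟩
      sent (ρ v) (r₁ v) w + sent (turn (r₁ v) (ρ v)) (r₂ v) w
        ≡⟨ cong (λ a → sent (ρ v) (r₁ v) w + sent a (r₂ v) w) (sym (ρ₁≗ v)) ⟩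
      sent (ρ v) (r₁ v) w + sent (ρ₁ v) (r₂ v) w                ∎
    regroup : ∀ a b c d → (a + b) - (c + d) ≡ (a - c) + (b - d)
    regroup = solve-∀

  Δ-vanishes : ∀ r ρ → (∀ (v : V₀) → Δ r ρ (proj₁ v) ≡ 0ℤ) → ∀ w → Δ r ρ w ≡ 0ℤ
  Δ-vanishes r ρ Δ≡0 w =
    trans (cong (_- firings r w) (inflow≡outflow isOutflow balanced w)) (+-inverseʳ (firings r w))
    where
    open Flow (allFin n) ∈-allFin
    isOutflow : IsOutflow (outflowFrom r ρ) (firings r)
    isOutflow = record { outflow = outflow ; nonneg = nonneg ; nonpos = nonpos }
      where
      outflow : ∀ u → ∑ (allFin n) (outflowFrom r ρ u) ≡ firings r u
      outflow u with T? (nonSink graph u)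
      ... | yes p = ∑-sent (ρ (u , p)) (r (u , p))
      ... | no  _ = ∑-zero (allFin n)
      nonneg : ∀ u v → 0ℤ ≤ firings r u → 0ℤ ≤ outflowFrom r ρ u v
      nonneg u v with T? (nonSink graph u)
      ... | yes p = sent-nonneg (ρ (u , p)) (r (u , p)) v
      ... | no  _ = λ _ → ≤-refl
      nonpos : ∀ u v → firings r u ≤ 0ℤ → outflowFrom r ρ u v ≤ 0ℤ
      nonpos u v with T? (nonSink graph u)
      ... | yes p = sent-nonpos (ρ (u , p)) (r (u , p)) v
      ... | no  _ = λ _ → ≤-refl
    balanced : ∀ v → firings r v ≢ 0ℤ → inflow (outflowFrom r ρ) v ≡ firings r v
    balanced v Rv≢0 = i-j≡0⇒i≡j _ _ (Δ≡0 (v , nonSink-v))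
      where
      nonSink-v : T (nonSink graph v)
      nonSink-v = decidable-stable (T? (nonSink graph v)) (λ ¬p → Rv≢0 (onV₀-sink r ¬p))

  routing-+ : ∀ {r r₁ r₂ ρ σ ρ₁ σ₁} → (∀ v → r v ≡ r₁ v + r₂ v) →
              routing r₁ (ρ , σ) ≈C (ρ₁ , σ₁) →
              routing r (ρ , σ) ≈C (turnBy r₂ ρ₁ , λ w → σ₁ w + Δ r₂ ρ₁ w)
  routing-+ {r} {r₁} {r₂} {ρ} {σ} {ρ₁} {σ₁} r≗r₁+r₂ (ρ₁≗ , σ₁≗) = rotors , particles
    where
    turned₁ : ∀ v → ρ₁ v ≡ turn (r₁ v) (ρ v)
    turned₁ v = trans (sym (ρ₁≗ v)) (proj₁ (routing-≈ r₁ ρ σ) v)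
    moved₁ : ∀ w → σ w + Δ r₁ ρ w ≡ σ₁ w
    moved₁ w = trans (sym (proj₂ (routing-≈ r₁ ρ σ) w)) (σ₁≗ w)
    rotors : ∀ v → proj₁ (routing r (ρ , σ)) v ≡ turn (r₂ v) (ρ₁ v)
    rotors v = begin
      proj₁ (routing r (ρ , σ)) v     ≡⟨ proj₁ (routing-≈ r ρ σ) v ⟩
      turn (r v) (ρ v)                ≡⟨ cong (λ k → turn k (ρ v)) (r≗r₁+r₂ v) ⟩
      turn (r₁ v + r₂ v) (ρ v)        ≡⟨ turn-+ (r₁ v) (r₂ v) (ρ v) ⟩
      turn (r₂ v) (turn (r₁ v) (ρ v)) ≡⟨ cong (turn (r₂ v)) (sym (turned₁ v)) ⟩
      turn (r₂ v) (ρ₁ v)              ∎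
      where open ≡-Reasoning
    particles : ∀ w → proj₂ (routing r (ρ , σ)) w ≡ σ₁ w + Δ r₂ ρ₁ w
    particles w = begin
      proj₂ (routing r (ρ , σ)) w   ≡⟨ proj₂ (routing-≈ r ρ σ) w ⟩
      σ w + Δ r ρ w                 ≡⟨ cong (_+_ (σ w)) (Δ-+ r≗r₁+r₂ turned₁ w) ⟩
      σ w + (Δ r₁ ρ w + Δ r₂ ρ₁ w)  ≡⟨ sym (+-assoc (σ w) (Δ r₁ ρ w) (Δ r₂ ρ₁ w)) ⟩
      σ w + Δ r₁ ρ w + Δ r₂ ρ₁ w    ≡⟨ cong (_+ Δ r₂ ρ₁ w) (moved₁ w) ⟩
      σ₁ w + Δ r₂ ρ₁ w              ∎
      where open ≡-Reasoning

  routing-fixes-particles : ∀ {r ρ σ ρ′} → routing r (ρ , σ) ≈C (ρ′ , σ) → ∀ w → Δ r ρ w ≡ 0ℤ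
  routing-fixes-particles {r} {ρ} {σ} (_ , σ≗) w = begin
    Δ r ρ w                          ≡⟨ sym (i+j-i≡j (σ w) (Δ r ρ w)) ⟩
    σ w + Δ r ρ w - σ w              ≡⟨ cong (_- σ w) (sym (proj₂ (routing-≈ r ρ σ) w)) ⟩
    proj₂ (routing r (ρ , σ)) w - σ w ≡⟨ cong (_- σ w) (σ≗ w) ⟩
    σ w - σ w                        ≡⟨ +-inverseʳ (σ w) ⟩
    0ℤ                               ∎
    where open ≡-Reasoning

  routingInf-unique : ∀ {ρ σ ρ₁ σ₁ ρ₂ σ₂} →
    InRoutingInf (ρ , σ) (ρ₁ , σ₁) → InRoutingInf (ρ , σ) (ρ₂ , σ₂) → (ρ₁ ∼ρ ρ₂) × (∀ v → σ₁ v ≡ σ₂ v)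
  routingInf-unique {ρ} {σ} {ρ₁} {σ₁} {ρ₂} {σ₂} (_ , (r₁ , reach₁) , empty₁) (_ , (r₂ , reach₂) , empty₂) =
    (σ₁ , r′ , rotors , particles) , (λ w → sym (trans (σ₂≗ w) (σ₁+Δ≡σ₁ w)))
    where
    r′ : V₀ → ℤ
    r′ v = r₂ v - r₁ v
    via : routing r₂ (ρ , σ) ≈C (turnBy r′ ρ₁ , λ w → σ₁ w + Δ r′ ρ₁ w)
    via = routing-+ (λ v → sym (i+[j-i]≡j (r₁ v) (r₂ v))) reach₁
    σ₂≗ : ∀ w → σ₂ w ≡ σ₁ w + Δ r′ ρ₁ w
    σ₂≗ w = trans (sym (proj₂ reach₂ w)) (proj₂ via w)
    Δ≡0-on-V₀ : ∀ (v : V₀) → Δ r′ ρ₁ (proj₁ v) ≡ 0ℤ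
    Δ≡0-on-V₀ v = begin
      Δ r′ ρ₁ (proj₁ v)                ≡⟨ sym (+-identityˡ _) ⟩
      0ℤ + Δ r′ ρ₁ (proj₁ v)           ≡⟨ cong (_+ Δ r′ ρ₁ (proj₁ v)) (sym (empty₁ v)) ⟩
      σ₁ (proj₁ v) + Δ r′ ρ₁ (proj₁ v) ≡⟨ sym (σ₂≗ (proj₁ v)) ⟩
      σ₂ (proj₁ v)                     ≡⟨ empty₂ v ⟩
      0ℤ                               ∎
      where open ≡-Reasoning
    σ₁+Δ≡σ₁ : ∀ w → σ₁ w + Δ r′ ρ₁ w ≡ σ₁ w
    σ₁+Δ≡σ₁ w = trans (cong (_+_ (σ₁ w)) (Δ-vanishes r′ ρ₁ Δ≡0-on-V₀ w)) (+-identityʳ (σ₁ w))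
    particles : ∀ w → proj₂ (routing r′ (ρ₁ , σ₁)) w ≡ σ₁ w
    particles w = trans (proj₂ (routing-≈ r′ ρ₁ σ₁) w) (σ₁+Δ≡σ₁ w)
    rotors : ∀ v → proj₁ (routing r′ (ρ₁ , σ₁)) v ≡ ρ₂ v
    rotors v = trans (proj₁ (routing-≈ r′ ρ₁ σ₁) v) (trans (sym (proj₁ via v)) (proj₁ reach₂ v))

  routingInf-∼ : ∀ {ρ σ ρ₁ σ₁ ρ₂ σ₂} → InRoutingInf (ρ , σ) (ρ₁ , σ₁) → IsRotorConfig ρ₂ →
                 ρ₁ ∼ρ ρ₂ → (∀ v → σ₁ v ≡ σ₂ v) → InRoutingInf (ρ , σ) (ρ₂ , σ₂)
  routingInf-∼ {ρ} {σ} {ρ₁} {σ₁} {ρ₂} {σ₂} (_ , (r₁ , reach₁) , empty₁) valid₂ (σ′ , r′ , reach′) σ₁≗σ₂ =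
    valid₂ , (r , rotors , particles) , (λ v → trans (sym (σ₁≗σ₂ (proj₁ v))) (empty₁ v))
    where
    r : V₀ → ℤ
    r v = r₁ v + r′ v
    via : routing r (ρ , σ) ≈C (turnBy r′ ρ₁ , λ w → σ₁ w + Δ r′ ρ₁ w)
    via = routing-+ (λ _ → refl) reach₁
    rotors : ∀ v → proj₁ (routing r (ρ , σ)) v ≡ ρ₂ v
    rotors v = trans (proj₁ via v) (trans (sym (proj₁ (routing-≈ r′ ρ₁ σ′) v)) (proj₁ reach′ v))
    particles : ∀ w → proj₂ (routing r (ρ , σ)) w ≡ σ₂ w
    particles w = trans (proj₂ via w) (trans (cong (_+_ (σ₁ w)) (routing-fixes-particles reach′ w))
                                             (trans (+-identityʳ (σ₁ w)) (σ₁≗σ₂ w)))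

theorem2 : (G : RotorGraph) → let open RG G in
    (ρ : RawRotor) (σ : PConf) → IsRotorConfig ρ →
    (ρ₁ : RawRotor) (σ₁ : PConf) → InRoutingInf (ρ , σ) (ρ₁ , σ₁) →
    (ρ₂ : RawRotor) (σ₂ : PConf) → IsRotorConfig ρ₂ →
    (InRoutingInf (ρ , σ) (ρ₂ , σ₂) ⇔ ((ρ₁ ∼ρ ρ₂) × (∀ v → σ₁ v ≡ σ₂ v)))
theorem2 G ρ σ _ ρ₁ σ₁ inf₁ ρ₂ σ₂ valid₂ =
  mk⇔ (routingInf-unique G inf₁) (uncurry (routingInf-∼ G inf₁ valid₂))
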